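{- For any connected graph $G$ of size $m\ge 3$, $\chi_i'(G)\le m-\mathrm{diam}(G)+2$. Moreover, equality holds if and only if $G$ is the path $P_{m+1}$.
   Context: All graphs are finite and simple; size is the number of edges, $\mathrm{diam}(G)$ the diameter, $P_{m+1}$ the path on $m+1$ vertices. Three edges $e_1,e_2,e_3$ (in this order) are consecutive if $e_1=xy$, $e_2=yz$, $e_3=zu$ for some vertices $x,y,z,u$ (where $x=u$ is allowed). An injective edge coloring of $G$ is a map $c:E(G)\to\mathcal{C}$ such that whenever $e_1,e_2,e_3$ are consecutive edges, $c(e_1)\neq c(e_3)$. $\chi_i'(G)$ is the minimum number of colors in an injective edge coloring of $G$. -}

module Defs where

open import Data.Nat using (ℕ; zero; suc; _+_; _∸_; _≤_; _<ᵇ_; _≡ᵇ_)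
open import Data.Bool using (Bool; true; false; _∧_; _∨_; if_then_else_)
open import Data.Fin using (Fin; toℕ)
open import Data.List using (List; map; allFin)
open import Data.Nat.ListAction using (sum)
open import Data.Product using (Σ; ∃; ∃-syntax; _×_; _,_)
open import Relation.Binary.PropositionalEquality using (_≡_)
open import Relation.Nullary using (¬_)
open import Function.Bundles using (_↔_; Inverse)

record Graph : Set where
  field
    n     : ℕ
    adj   : Fin n → Fin n → Bool
    sym   : ∀ x y → adj x y ≡ adj y x
    irrefl : ∀ x → adj x x ≡ false

open Graph public

Adj : (G : Graph) → Fin (n G) → Fin (n G) → Set
Adj G x y = adj G x y ≡ true

size : Graph → ℕ
size G = sum (map (λ i → sum (map (λ j →
           if (toℕ i <ᵇ toℕ j) ∧ adj G i j then 1 else 0) (allFin (n G)))) (allFin (n G)))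

data Walk (G : Graph) : Fin (n G) → Fin (n G) → ℕ → Set where
  nil  : ∀ {x} → Walk G x x 0
  cons : ∀ {x y z l} → Adj G x y → Walk G y z l → Walk G x z (suc l)

Connected : Graph → Set
Connected G = ∀ x y → ∃[ l ] Walk G x y l

IsDist : (G : Graph) → Fin (n G) → Fin (n G) → ℕ → Set
IsDist G x y d = Walk G x y d × (∀ l → Walk G x y l → d ≤ l)

IsDiam : Graph → ℕ → Set
IsDiam G D = (∃[ x ] ∃[ y ] IsDist G x y D)
           × (∀ x y d → IsDist G x y d → d ≤ D)

-- An edge coloring with k colors, represented as a symmetric function on
-- ordered vertex pairs (its values on non-adjacent pairs are irrelevant);
-- the color of edge xy is c x y = c y x.
record EdgeColoring (G : Graph) (k : ℕ) : Set where
  field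
    col    : Fin (n G) → Fin (n G) → Fin k
    colSym : ∀ x y → Adj G x y → col x y ≡ col y x

open EdgeColoring public

-- Three edges e1 = xy, e2 = yz, e3 = zu are consecutive; they are three
-- (distinct) edges, which for a simple graph amounts to x ≠ z and y ≠ u
-- (x = u is allowed: a triangle).
Consecutive : (G : Graph) → (x y z u : Fin (n G)) → Set
Consecutive G x y z u = Adj G x y × Adj G y z × Adj G z u × ¬ (x ≡ z) × ¬ (y ≡ u)

IsInjective : (G : Graph) {k : ℕ} → EdgeColoring G k → Set
IsInjective G c = ∀ x y z u → Consecutive G x y z u → ¬ (col c x y ≡ col c z u)

InjColorable : Graph → ℕ → Set
InjColorable G k = Σ (EdgeColoring G k) (IsInjective G)

IsInjChromIndex : Graph → ℕ → Set
IsInjChromIndex G k = InjColorable G k × (∀ j → InjColorable G j → k ≤ j)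

pathAdj : (m : ℕ) → Fin (suc m) → Fin (suc m) → Bool
pathAdj m i j = (suc (toℕ i) ≡ᵇ toℕ j) ∨ (suc (toℕ j) ≡ᵇ toℕ i)

IsoToPath : (G : Graph) (m : ℕ) → Set
IsoToPath G m = Σ (Fin (n G) ↔ Fin (suc m)) λ f →
  ∀ x y → adj G x y ≡ pathAdj m (Inverse.to f x) (Inverse.to f y)

module Submission where

-- If a set Q of edges carries a colouring with r+1 colours
-- that is injective on consecutive triples, giving every other edge a private colour
-- yields an injective edge colouring; so if Q has at least L edges,
-- χ'_i(G) ≤ (r+1) + (m − L).  On a diametral (shortest) path v₀ … v_D, colour edge t by the stripe
-- pattern 0,0,1,1,0,0,1,1,…: end edges of a consecutive triple on a geodesic are two
-- steps apart, so r+1 = 2 and L = D.  If some vertex is off the path, one such vertex w is adjacent to it, and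
-- w is a pendant vertex at v_i, the middle of a detour v_a w v_{a+2}, or the apex of
-- a triangle v_a w v_{a+1}; each time Q can be enlarged to L = D + r edges, which
-- gives χ'_i(G) ≤ m − D + 1.  Otherwise the path spans G, all edges are path edges,
-- m = D and G ≅ P_{m+1}.  Conversely P_{m+1} has diameter m and needs two colours.

open import Defs hiding (sym)
open import Defs using () renaming (sym to adj-sym)
open import Data.Nat using (ℕ; zero; suc; pred; _+_; _*_; _∸_; _≤_; _<_; z≤n; s≤s; _<ᵇ_; _≤ᵇ_; _≡ᵇ_; _≤?_; _<?_; _⊓_)
open import Data.Nat.Properties
open import Algebra.Properties.CommutativeSemigroup +-commutativeSemigroup using (interchange)
open import Data.Bool using (Bool; true; false; T; _∧_; _∨_; not; if_then_else_)
open import Data.Bool.Properties using (∧-comm; ∨-comm; ∧-zeroʳ) renaming (_≟_ to _≟B_)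
open import Data.Unit using (tt)
open import Data.Fin using (Fin; toℕ; zero; suc; _↑ˡ_; _↑ʳ_; splitAt; fromℕ<; fromℕ) renaming (_≟_ to _≟F_)
open import Data.Fin.Properties using (toℕ-injective; ↑ˡ-injective; ↑ʳ-injective; splitAt-↑ˡ; splitAt-↑ʳ; toℕ<n; toℕ-fromℕ<; injective⇒≤; any?)
open import Data.List using (List; []; _∷_; [_]; map; allFin; length; lookup; concatMap)
open import Data.List.Properties using (length-++; map-cong)
open import Data.Nat.ListAction using (sum)
open import Data.List.Membership.Propositional using (_∈_; lose)
open import Data.List.Membership.Propositional.Properties using (∈-allFin; ∈-concatMap⁺)
open import Data.List.Relation.Unary.Any using (here; index)
open import Data.List.Relation.Unary.Any.Properties using (lookup-index)
open import Data.Product using (Σ; ∃; _×_; _,_; proj₁; proj₂)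
open import Data.Sum using (_⊎_; inj₁; inj₂)
open import Data.Empty using (⊥; ⊥-elim)
open import Relation.Nullary using (¬_; yes; no; Dec; does)
open import Relation.Nullary.Decidable using (_×-dec_; map′)
open import Relation.Binary.Definitions using (tri<; tri≈; tri>)
open import Data.Nat.Tactic.RingSolver using (solve-∀)
open import Relation.Binary.PropositionalEquality hiding ([_])
open import Function.Bundles using (_↔_; Inverse; _⇔_; mk⇔; mk↔ₛ′)

module Counting {n : ℕ} where

  indicator : Bool → ℕ
  indicator b = if b then 1 else 0

  -- The number of pairs (i , j) of Fin n with c i j.  By definition, `size G` is the
  -- count of the relation "toℕ i < toℕ j and i ~ j".
  count : (Fin n → Fin n → Bool) → ℕ
  count c = sum (map (λ i → sum (map (λ j → indicator (c i j)) (allFin n))) (allFin n))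

  sum-map-+ : {A : Set} (f g : A → ℕ) (xs : List A) →
    sum (map (λ x → f x + g x) xs) ≡ sum (map f xs) + sum (map g xs)
  sum-map-+ f g [] = refl
  sum-map-+ f g (x ∷ xs) = trans (cong (f x + g x +_) (sum-map-+ f g xs))
                                 (interchange (f x) (g x) (sum (map f xs)) (sum (map g xs)))

  indicator-split : ∀ a b → indicator a ≡ indicator (a ∧ b) + indicator (a ∧ not b)
  indicator-split true true = refl
  indicator-split true false = refl
  indicator-split false b = refl

  count-split : (c q : Fin n → Fin n → Bool) → count c ≡ count (λ i j → c i j ∧ q i j) + count (λ i j → c i j ∧ not (q i j))
  count-split c q =
    trans (cong sum (map-cong (λ i →
             trans (cong sum (map-cong (λ j → indicator-split (c i j) (q i j)) (allFin n)))
                   (sum-map-+ (λ j → indicator (both i j)) (λ j → indicator (only i j)) (allFin n)))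
                  (allFin n)))
          (sum-map-+ (row both) (row only) (allFin n))
    where
    both only : Fin n → Fin n → Bool
    both i j = c i j ∧ q i j
    only i j = c i j ∧ not (q i j)
    row : (Fin n → Fin n → Bool) → Fin n → ℕ
    row r i = sum (map (λ j → indicator (r i j)) (allFin n))

  sum-zeros : {A : Set} (xs : List A) → sum (map (λ _ → 0) xs) ≡ 0
  sum-zeros [] = refl
  sum-zeros (x ∷ xs) = sum-zeros xs

  count-empty : ∀ c → (∀ i j → c i j ≡ false) → count c ≡ 0
  count-empty c empty =
    trans (cong sum (map-cong (λ i →
             trans (cong sum (map-cong (λ j → cong indicator (empty i j)) (allFin n)))
                   (sum-zeros (allFin n))) (allFin n)))
          (sum-zeros (allFin n))

  witnesses : (Fin n → Fin n → Bool) → List (Fin n × Fin n)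
  witnesses c = concatMap (λ i → concatMap (λ j → if c i j then [ (i , j) ] else []) (allFin n)) (allFin n)

  length-concatMap : {A B : Set} (f : A → List B) (xs : List A) →
    length (concatMap f xs) ≡ sum (map (λ x → length (f x)) xs)
  length-concatMap f [] = refl
  length-concatMap f (x ∷ xs) = trans (length-++ (f x)) (cong (length (f x) +_) (length-concatMap f xs))

  length-singleton : {A : Set} (b : Bool) (a : A) → length (if b then [ a ] else []) ≡ indicator b
  length-singleton true a = refl
  length-singleton false a = refl

  length-witnesses : ∀ c → length (witnesses c) ≡ count c
  length-witnesses c =
    trans (length-concatMap _ (allFin n)) (cong sum (map-cong (λ i →
      trans (length-concatMap _ (allFin n)) (cong sum (map-cong (λ j →
        length-singleton (c i j) (i , j)) (allFin n)))) (allFin n)))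

  ∈-witnesses : ∀ c {i j} → c i j ≡ true → (i , j) ∈ witnesses c
  ∈-witnesses c {i} {j} cij = ∈-concatMap⁺ _ (lose (∈-allFin i) (∈-concatMap⁺ _ (lose (∈-allFin j) here-ij)))
    where
    here-ij : (i , j) ∈ (if c i j then [ (i , j) ] else [])
    here-ij rewrite cij = here refl

  count-lower : ∀ c (L : ℕ) (e : Fin L → Fin n × Fin n) → (∀ t → c (proj₁ (e t)) (proj₂ (e t)) ≡ true) →
    (∀ t t' → e t ≡ e t' → t ≡ t') → L ≤ count c
  count-lower c L e holds distinct = subst (L ≤_) (length-witnesses c) (injective⇒≤ position-injective)
    where
    position : Fin L → Fin (length (witnesses c))
    position t = index (∈-witnesses c (holds t))
    position-injective : ∀ {t t'} → position t ≡ position t' → t ≡ t'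
    position-injective {t} {t'} eq = distinct t t'
      (trans (lookup-index (∈-witnesses c (holds t)))
        (trans (cong (lookup (witnesses c)) eq) (sym (lookup-index (∈-witnesses c (holds t'))))))

true≢false : ¬ true ≡ false
true≢false ()

adjSym : (G : Graph) → ∀ {x y} → Adj G x y → Adj G y x
adjSym G {x} {y} a = trans (adj-sym G y x) a

adjNeq : (G : Graph) → ∀ {x y} → Adj G x y → ¬ x ≡ y
adjNeq G {x} a refl with trans (sym (irrefl G x)) a
... | ()

consecutive-reverse : (G : Graph) → ∀ {x y z u} → Consecutive G x y z u → Consecutive G u z y x
consecutive-reverse G (a , b , c , x≢z , y≢u) =
  adjSym G c , adjSym G b , adjSym G a , (λ u≡y → y≢u (sym u≡y)) , (λ z≡x → x≢z (sym z≡x))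

consecutive-distinct : (G : Graph) → ∀ {x y z u} → Consecutive G x y z u →
  ¬ ((x ≡ z × y ≡ u) ⊎ (x ≡ u × y ≡ z))
consecutive-distinct G (_ , _ , _ , x≢z , _) (inj₁ (x≡z , _)) = x≢z x≡z
consecutive-distinct G (_ , b , _ , _ , _) (inj₂ (_ , y≡z)) = adjNeq G b y≡z

-- The unordered pair {x , y} of vertices, represented by the ordered pair (min , max);
-- used to give each edge a single index.
module EdgeKey {n : ℕ} where

  lt : Fin n → Fin n → Bool
  lt x y = toℕ x <ᵇ toℕ y

  lt-true : ∀ x y → lt x y ≡ true → toℕ x < toℕ y
  lt-true x y e = <ᵇ⇒< (toℕ x) (toℕ y) (subst T (sym e) tt)

  lt-neither : ∀ x y → lt x y ≡ false → lt y x ≡ false → x ≡ y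
  lt-neither x y e₁ e₂ = toℕ-injective (≤-antisym (≮⇒≥ (not-lt y x e₂)) (≮⇒≥ (not-lt x y e₁)))
    where
    not-lt : ∀ a b → lt a b ≡ false → ¬ toℕ a < toℕ b
    not-lt a b e a<b = subst T e (<⇒<ᵇ a<b)

  key : Fin n → Fin n → Fin n × Fin n
  key x y = if lt x y then (x , y) else (y , x)

  key-cases : ∀ x y → (key x y ≡ (x , y)) ⊎ (key x y ≡ (y , x))
  key-cases x y with lt x y
  ... | true = inj₁ refl
  ... | false = inj₂ refl

  key-both : (P : Fin n → Fin n → Set) → ∀ x y → P x y → P y x → P (proj₁ (key x y)) (proj₂ (key x y))
  key-both P x y p q with lt x y
  ... | true = p
  ... | false = q

  key-sym : ∀ x y → ¬ x ≡ y → key x y ≡ key y x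
  key-sym x y x≢y with lt x y in e₁ | lt y x in e₂
  ... | true | true = ⊥-elim (<-asym (lt-true x y e₁) (lt-true y x e₂))
  ... | true | false = refl
  ... | false | true = refl
  ... | false | false = ⊥-elim (x≢y (lt-neither x y e₁ e₂))

  key-ordered : ∀ x y → ¬ x ≡ y → lt (proj₁ (key x y)) (proj₂ (key x y)) ≡ true
  key-ordered x y x≢y with lt x y in e₁
  ... | true = e₁
  ... | false with lt y x in e₂
  ...   | true = refl
  ...   | false = ⊥-elim (x≢y (lt-neither x y e₁ e₂))

  key-injective : ∀ x y z u → key x y ≡ key z u → (x ≡ z × y ≡ u) ⊎ (x ≡ u × y ≡ z)
  key-injective x y z u e with key-cases x y | key-cases z u
  ... | inj₁ p | inj₁ q with trans (sym p) (trans e q)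
  ...   | refl = inj₁ (refl , refl)
  key-injective x y z u e | inj₁ p | inj₂ q with trans (sym p) (trans e q)
  ...   | refl = inj₂ (refl , refl)
  key-injective x y z u e | inj₂ p | inj₁ q with trans (sym p) (trans e q)
  ...   | refl = inj₂ (refl , refl)
  key-injective x y z u e | inj₂ p | inj₂ q with trans (sym p) (trans e q)
  ...   | refl = inj₁ (refl , refl)

-- The data of the partial colouring lemma: a symmetric set Q of vertex pairs, a
-- colouring with r+1 colours of the edges in Q that is injective on every consecutive
-- triple whose end edges lie in Q, and L listed edges of Q, told apart by a symmetric
-- labelling of pairs.
record PartialColouring (G : Graph) (L r : ℕ) : Set where
  field
    inQ          : Fin (n G) → Fin (n G) → Bool
    inQ-sym      : ∀ x y → inQ x y ≡ inQ y x
    colour       : Fin (n G) → Fin (n G) → Fin (suc r)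
    colour-sym   : ∀ x y → Adj G x y → inQ x y ≡ true → colour x y ≡ colour y x
    colour-inj   : ∀ x y z u → Consecutive G x y z u → inQ x y ≡ true → inQ z u ≡ true →
                   ¬ colour x y ≡ colour z u
    end₁ end₂    : ℕ → Fin (n G)
    listed-adj   : ∀ t → t < L → Adj G (end₁ t) (end₂ t)
    listed-inQ   : ∀ t → t < L → inQ (end₁ t) (end₂ t) ≡ true
    label        : Fin (n G) → Fin (n G) → ℕ
    label-sym    : ∀ x y → label x y ≡ label y x
    label-listed : ∀ t → t < L → label (end₁ t) (end₂ t) ≡ t

-- Colour the edges of Q as prescribed and give every
-- other edge a private colour: this is an injective edge colouring with
-- (r+1) + #(edges outside Q) colours, and Q contains at least L edges.
module Extend {G : Graph} {L r : ℕ} (P : PartialColouring G L r) where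
  open PartialColouring P
  open Counting
  open EdgeKey

  V : Set
  V = Fin (n G)

  uncovered : V → V → Bool
  uncovered x y = (lt x y ∧ adj G x y) ∧ not (inQ x y)

  N : ℕ
  N = length (witnesses uncovered)

  privateColour′ : ∀ i j (b : Bool) → uncovered i j ≡ b → Fin (suc r + N)
  privateColour′ i j true e = suc r ↑ʳ index (∈-witnesses uncovered e)
  privateColour′ i j false e = zero

  privateColour : V × V → Fin (suc r + N)
  privateColour (i , j) = privateColour′ i j (uncovered i j) refl

  extended : V → V → Fin (suc r + N)
  extended x y = if inQ x y then colour x y ↑ˡ N else privateColour (key x y)

  extended-inQ : ∀ x y → inQ x y ≡ true → extended x y ≡ colour x y ↑ˡ N
  extended-inQ x y e rewrite e = refl

  key-uncovered : ∀ x y → Adj G x y → inQ x y ≡ false → uncovered (proj₁ (key x y)) (proj₂ (key x y)) ≡ true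
  key-uncovered x y a notQ = uncovered-intro (key-ordered x y (adjNeq G a))
    (key-both (Adj G) x y a (adjSym G a))
    (key-both (λ i j → inQ i j ≡ false) x y notQ (trans (inQ-sym y x) notQ))
    where
    uncovered-intro : ∀ {i j} → lt i j ≡ true → adj G i j ≡ true → inQ i j ≡ false → uncovered i j ≡ true
    uncovered-intro e₁ e₂ e₃ rewrite e₁ | e₂ | e₃ = refl

  extended-private : ∀ x y → Adj G x y → inQ x y ≡ false →
    Σ (Fin N) λ t → (extended x y ≡ suc r ↑ʳ t) × (lookup (witnesses uncovered) t ≡ key x y)
  extended-private x y a notQ rewrite notQ = private-position (key-uncovered x y a notQ)
    where
    position′ : ∀ i j b (e : uncovered i j ≡ b) → b ≡ true →
      Σ (Fin N) λ t → (privateColour′ i j b e ≡ suc r ↑ʳ t) × (lookup (witnesses uncovered) t ≡ (i , j))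
    position′ i j true e refl = _ , refl , sym (lookup-index (∈-witnesses uncovered e))
    private-position : ∀ {i j} → uncovered i j ≡ true →
      Σ (Fin N) λ t → (privateColour (i , j) ≡ suc r ↑ʳ t) × (lookup (witnesses uncovered) t ≡ (i , j))
    private-position {i} {j} e = position′ i j (uncovered i j) refl e

  ↑ˡ≢↑ʳ : ∀ (c : Fin (suc r)) (t : Fin N) → ¬ c ↑ˡ N ≡ suc r ↑ʳ t
  ↑ˡ≢↑ʳ c t e with trans (sym (splitAt-↑ˡ (suc r) c N)) (trans (cong (splitAt (suc r)) e) (splitAt-↑ʳ (suc r) N t))
  ... | ()

  extended-sym : ∀ x y → Adj G x y → extended x y ≡ extended y x
  extended-sym x y a with inQ x y in e₁ | inQ y x in e₂
  ... | true | true = cong (_↑ˡ N) (colour-sym x y a e₁)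
  ... | false | false = cong privateColour (key-sym x y (adjNeq G a))
  ... | true | false = ⊥-elim (true≢false (trans (sym e₁) (trans (inQ-sym x y) e₂)))
  ... | false | true = ⊥-elim (true≢false (sym (trans (sym e₁) (trans (inQ-sym x y) e₂))))

  colouring : EdgeColoring G (suc r + N)
  colouring = record { col = extended ; colSym = extended-sym }

  -- Q-colours and private colours never clash, and private colours are distinct
  -- for distinct edges.
  colouring-injective : IsInjective G colouring
  colouring-injective x y z u c eq = by-cases (inQ x y) refl (inQ z u) refl
    where
    c₁ = proj₁ c
    c₃ = proj₁ (proj₂ (proj₂ c))
    by-cases : ∀ b₁ → inQ x y ≡ b₁ → ∀ b₂ → inQ z u ≡ b₂ → ⊥
    by-cases true q₁ true q₂ = colour-inj x y z u c q₁ q₂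
      (↑ˡ-injective N _ _ (trans (sym (extended-inQ x y q₁)) (trans eq (extended-inQ z u q₂))))
    by-cases true q₁ false q₂ with extended-private z u c₃ q₂
    ... | t , p , _ = ↑ˡ≢↑ʳ _ t (trans (sym (extended-inQ x y q₁)) (trans eq p))
    by-cases false q₁ true q₂ with extended-private x y c₁ q₁
    ... | t , p , _ = ↑ˡ≢↑ʳ _ t (trans (sym (extended-inQ z u q₂)) (trans (sym eq) p))
    by-cases false q₁ false q₂ with extended-private x y c₁ q₁ | extended-private z u c₃ q₂
    ... | s , p , k | t , p′ , k′ = consecutive-distinct G c (key-injective x y z u
      (trans (sym k) (trans (cong (lookup (witnesses uncovered)) (↑ʳ-injective (suc r) s t (trans (sym p) (trans eq p′)))) k′)))

  uncoveredCount : ℕ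
  uncoveredCount = count uncovered

  colour-bound : ∀ k → IsInjChromIndex G k → k ≤ suc r + uncoveredCount
  colour-bound k (_ , minimal) =
    subst (λ m → k ≤ suc r + m) (length-witnesses uncovered) (minimal _ (colouring , colouring-injective))

  covered : V → V → Bool
  covered x y = (lt x y ∧ adj G x y) ∧ inQ x y

  listed-covered : L ≤ count covered
  listed-covered = count-lower covered L edge edge-covered edge-distinct
    where
    edge : Fin L → V × V
    edge t = key (end₁ (toℕ t)) (end₂ (toℕ t))
    covered-intro : ∀ {i j} → lt i j ≡ true → adj G i j ≡ true → inQ i j ≡ true → covered i j ≡ true
    covered-intro e₁ e₂ e₃ rewrite e₁ | e₂ | e₃ = refl
    edge-covered : ∀ t → covered (proj₁ (edge t)) (proj₂ (edge t)) ≡ true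
    edge-covered t = covered-intro (key-ordered _ _ (adjNeq G a))
      (key-both (Adj G) _ _ a (adjSym G a))
      (key-both (λ i j → inQ i j ≡ true) _ _ q (trans (inQ-sym _ _) q))
      where a = listed-adj _ (toℕ<n t)
            q = listed-inQ _ (toℕ<n t)
    edge-distinct : ∀ t t′ → edge t ≡ edge t′ → t ≡ t′
    edge-distinct t t′ eq with key-injective _ _ _ _ eq
    ... | inj₁ (p , q) = toℕ-injective (trans (sym (label-listed _ (toℕ<n t)))
            (trans (cong₂ label p q) (label-listed _ (toℕ<n t′))))
    ... | inj₂ (p , q) = toℕ-injective (trans (sym (label-listed _ (toℕ<n t)))
            (trans (cong₂ label p q) (trans (label-sym _ _) (label-listed _ (toℕ<n t′)))))

  covered-bound : uncoveredCount + L ≤ size G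
  covered-bound = begin
    uncoveredCount + L                   ≤⟨ +-monoʳ-≤ uncoveredCount listed-covered ⟩
    uncoveredCount + count covered       ≡⟨ +-comm uncoveredCount (count covered) ⟩
    count covered + uncoveredCount       ≡⟨ count-split (λ x y → lt x y ∧ adj G x y) inQ ⟨
    size G                               ∎
    where open ≤-Reasoning

  all-covered : (∀ x y → Adj G x y → inQ x y ≡ true) → uncoveredCount ≡ 0
  all-covered inQ-all = count-empty uncovered none
    where
    none : ∀ i j → uncovered i j ≡ false
    none i j with adj G i j in a
    ... | false = cong (_∧ not (inQ i j)) (∧-zeroʳ (lt i j))
    ... | true = trans (cong (λ b → (lt i j ∧ true) ∧ not b) (inQ-all i j a)) (∧-zeroʳ (lt i j ∧ true))

partial-bound : ∀ {G L r k} → PartialColouring G L r → IsInjChromIndex G k →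
  (k + L ≤ suc r + size G) × (L ≤ size G)
partial-bound {G} {L} {r} {k} P χ = (begin
    k + L                     ≤⟨ +-monoˡ-≤ L (colour-bound k χ) ⟩
    suc r + uncoveredCount + L   ≡⟨ +-assoc (suc r) uncoveredCount L ⟩
    suc r + (uncoveredCount + L) ≤⟨ +-monoʳ-≤ (suc r) covered-bound ⟩
    suc r + size G            ∎) ,
  ≤-trans (m≤n+m L uncoveredCount) covered-bound
  where open Extend P
        open ≤-Reasoning

no-equality : ∀ {G L r} D k → PartialColouring G L r → D + r ≤ L → IsInjChromIndex G k →
  ¬ k ≡ size G ∸ D + 2
no-equality {G} {L} {r} D k P D+r≤L χ refl = 1+n≰n (+-cancelʳ-≤ r _ _ (begin
  suc (suc (size G)) + r      ≤⟨ +-monoˡ-≤ r (s≤s (s≤s (m≤n+m∸n (size G) D))) ⟩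
  2 + (D + (size G ∸ D)) + r  ≡⟨ rearrange (size G ∸ D) D r ⟩
  (size G ∸ D + 2) + (D + r)  ≤⟨ +-monoʳ-≤ (size G ∸ D + 2) D+r≤L ⟩
  (size G ∸ D + 2) + L        ≤⟨ proj₁ (partial-bound P χ) ⟩
  suc r + size G              ≡⟨ +-comm (suc r) (size G) ⟩
  size G + suc r              ≡⟨ +-suc (size G) r ⟩
  suc (size G) + r            ∎))
  where
  open ≤-Reasoning
  rearrange : ∀ s d q → 2 + (d + s) + q ≡ (s + 2) + (d + q)
  rearrange = solve-∀

module Walks {G : Graph} where

  vertex : ∀ {x y l} → Walk G x y l → ℕ → Fin (n G)
  vertex {x} nil j = x
  vertex {x} (cons a w) zero = x
  vertex (cons a w) (suc j) = vertex w j

  vertex-start : ∀ {x y l} (w : Walk G x y l) → vertex w 0 ≡ x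
  vertex-start nil = refl
  vertex-start (cons a w) = refl

  vertex-step : ∀ {x y l} (w : Walk G x y l) j → j < l → Adj G (vertex w j) (vertex w (suc j))
  vertex-step (cons a w) zero _ = subst (Adj G _) (sym (vertex-start w)) a
  vertex-step (cons a w) (suc j) (s≤s j<l) = vertex-step w j j<l

  take : ∀ {x y l} (w : Walk G x y l) j → j ≤ l → Walk G x (vertex w j) j
  take nil zero _ = nil
  take (cons a w) zero _ = nil
  take (cons a w) (suc j) (s≤s j≤l) = cons a (take w j j≤l)

  drop : ∀ {x y l} (w : Walk G x y l) j → j ≤ l → Walk G (vertex w j) y (l ∸ j)
  drop nil zero _ = nil
  drop (cons a w) zero _ = cons a w
  drop (cons a w) (suc j) (s≤s j≤l) = drop w j j≤l

  _++ʷ_ : ∀ {x y z a b} → Walk G x y a → Walk G y z b → Walk G x z (a + b)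
  nil ++ʷ w = w
  cons e v ++ʷ w = cons e (v ++ʷ w)

  snoc : ∀ {x y z a} → Walk G x y a → Adj G y z → Walk G x z (suc a)
  snoc nil e = cons e nil
  snoc (cons e v) f = cons e (snoc v f)

  reverse : ∀ {x y l} → Walk G x y l → Walk G y x l
  reverse nil = nil
  reverse (cons e v) = snoc (reverse v) (adjSym G e)

  edge : ∀ {x y} → Adj G x y → Walk G x y 1
  edge e = cons e nil

-- The stripe pattern false, false, true, true, false, false, … of period 4.  Colouring
-- the t-th edge of a path by `stripe t` separates any two edges two steps apart.
stripe : ℕ → Bool
stripe zero = false
stripe (suc zero) = false
stripe (suc (suc k)) = not (stripe k)

not-≢ : ∀ b → ¬ not b ≡ b
not-≢ true ()
not-≢ false ()

stripe-+2 : ∀ c m → ¬ stripe (c + m) ≡ stripe (c + suc (suc m))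
stripe-+2 c m e rewrite +-suc c (suc m) | +-suc c m = not-≢ (stripe (c + m)) (sym e)

stripe-odd : ∀ m → stripe (suc (m + m)) ≡ stripe (m + m)
stripe-odd zero = refl
stripe-odd (suc m) rewrite +-suc m m = cong not (stripe-odd m)

stripe-4m : ∀ m → stripe (m * 4) ≡ false
stripe-4m zero = refl
stripe-4m (suc m) = cong not (cong not (stripe-4m m))

stripe-4m+1 : ∀ m → stripe (suc (m * 4)) ≡ false
stripe-4m+1 zero = refl
stripe-4m+1 (suc m) = cong not (cong not (stripe-4m+1 m))

-- Neighbouring positions on the number line (|p − q| = 1): the shape of an edge of a
-- path, read through the positions of its end vertices.
data Nbr : ℕ → ℕ → Set where
  up : ∀ {a} → Nbr a (suc a)
  dn : ∀ {a} → Nbr (suc a) a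

nbr-sym : ∀ {a b} → Nbr a b → Nbr b a
nbr-sym up = dn
nbr-sym dn = up

nbr-≢ : ∀ {a b} → Nbr a b → ¬ a ≡ b
nbr-≢ up e = 1+n≢n (sym e)
nbr-≢ dn e = 1+n≢n e

mkNbr : ∀ a b → b ≤ suc a → a ≤ suc b → ¬ a ≡ b → Nbr a b
mkNbr zero zero _ _ a≢b = ⊥-elim (a≢b refl)
mkNbr zero (suc zero) _ _ _ = up
mkNbr zero (suc (suc b)) (s≤s ()) _ _
mkNbr (suc zero) zero _ _ _ = dn
mkNbr (suc (suc a)) zero _ (s≤s ()) _
mkNbr (suc a) (suc b) (s≤s p) (s≤s q) a≢b with mkNbr a b p q (λ e → a≢b (cong suc e))
... | up = up
... | dn = dn

-- the Boolean neighbour test; `pathAdj m i j` is `nbrᵇ (toℕ i) (toℕ j)`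
nbrᵇ : ℕ → ℕ → Bool
nbrᵇ p q = (suc p ≡ᵇ q) ∨ (suc q ≡ᵇ p)

nbrᵇ-sound : ∀ p q → nbrᵇ p q ≡ true → Nbr p q
nbrᵇ-sound p q e with suc p ≡ᵇ q in e₁
... | true = subst (Nbr p) (≡ᵇ⇒≡ (suc p) q (subst T (sym e₁) tt)) up
... | false = subst (λ t → Nbr t q) (≡ᵇ⇒≡ (suc q) p (subst T (sym e) tt)) dn

≡ᵇ-refl : ∀ m → (m ≡ᵇ m) ≡ true
≡ᵇ-refl zero = refl
≡ᵇ-refl (suc m) = ≡ᵇ-refl m

nbrᵇ-complete : ∀ {p q} → Nbr p q → nbrᵇ p q ≡ true
nbrᵇ-complete {p} up rewrite ≡ᵇ-refl p = refl
nbrᵇ-complete {q = q} dn rewrite ≡ᵇ-refl q = ∨-comm _ true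

-- The relative positions of two numbers at most two apart (as are two path neighbours
-- of a common vertex).
data Near : ℕ → ℕ → Set where
  same : ∀ {i} → Near i i
  m1 : ∀ {j} → Near j (suc j)
  p1 : ∀ {i} → Near (suc i) i
  m2 : ∀ {j} → Near j (suc (suc j))
  p2 : ∀ {i} → Near (suc (suc i)) i

near : ∀ j i → j ≤ 2 + i → i ≤ 2 + j → Near j i
near zero zero _ _ = same
near (suc zero) zero _ _ = p1
near (suc (suc zero)) zero _ _ = p2
near (suc (suc (suc j))) zero (s≤s (s≤s ())) _
near zero (suc zero) _ _ = m1
near zero (suc (suc zero)) _ _ = m2
near zero (suc (suc (suc i))) _ (s≤s (s≤s ()))
near (suc j) (suc i) (s≤s h₁) (s≤s h₂) with near j i h₁ h₂
... | same = same
... | m1 = m1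
... | p1 = p1
... | m2 = m2
... | p2 = p2

-- The lower end of the edge {p , q} of the number line; edge t of a path is {t , t+1}.
lo : ℕ → ℕ → ℕ
lo = _⊓_

lo-up : ∀ a → lo a (suc a) ≡ a
lo-up a = m≤n⇒m⊓n≡m (n≤1+n a)

lo-dn : ∀ a → lo (suc a) a ≡ a
lo-dn a = m≥n⇒m⊓n≡n (n≤1+n a)

lo-sym : ∀ a b → lo a b ≡ lo b a
lo-sym = ⊓-comm

-- Three steps p → q → r → s on the number line that never backtrack go monotonically,
-- so the lower ends of the first and last step are two apart.
lo-three-steps : ∀ {p q r s} → Nbr p q → Nbr q r → Nbr r s → ¬ p ≡ r → ¬ q ≡ s →
  (lo r s ≡ suc (suc (lo p q))) ⊎ (lo p q ≡ suc (suc (lo r s)))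
lo-three-steps {p} up up up _ _ = inj₁ (trans (lo-up (suc (suc p))) (cong (λ t → suc (suc t)) (sym (lo-up p))))
lo-three-steps up up dn _ q≢s = ⊥-elim (q≢s refl)
lo-three-steps up dn _ p≢r _ = ⊥-elim (p≢r refl)
lo-three-steps dn up _ p≢r _ = ⊥-elim (p≢r refl)
lo-three-steps dn dn up _ q≢s = ⊥-elim (q≢s refl)
lo-three-steps {s = s} dn dn dn _ _ = inj₂ (trans (lo-dn (suc (suc s))) (cong (λ t → suc (suc t)) (sym (lo-dn s))))

stripe-three-steps : ∀ c {p q r s} → Nbr p q → Nbr q r → Nbr r s → ¬ p ≡ r → ¬ q ≡ s →
  ¬ stripe (c + lo p q) ≡ stripe (c + lo r s)
stripe-three-steps c n₁ n₂ n₃ p≢r q≢s e with lo-three-steps n₁ n₂ n₃ p≢r q≢s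
... | inj₁ h = stripe-+2 c (lo _ _) (trans e (cong (λ t → stripe (c + t)) h))
... | inj₂ h = stripe-+2 c (lo _ _) (trans (sym e) (cong (λ t → stripe (c + t)) h))

-- A chord {a , a+2} of the number line (it arises when a triangle is inserted into a path).
Chord : ℕ → ℕ → ℕ → Set
Chord a p q = ((p ≡ a) × (q ≡ suc (suc a))) ⊎ ((p ≡ suc (suc a)) × (q ≡ a))

-- With the stripe colouring shifted by a+1, the edges {a−1,a} and {a,a+1} get the colour
-- of 2a and the edges {a+2,a+3} and {a+1,a+2} the other colour; so consecutive triples
-- through the chord {a , a+2} are separated too.
stripe-across-chord : ∀ a {p₁ p₂ p₃ p₄} → Nbr p₁ p₂ → p₂ ≡ a → p₃ ≡ suc (suc a) → Nbr p₃ p₄ →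
  ¬ stripe (suc a + lo p₁ p₂) ≡ stripe (suc a + lo p₃ p₄)
stripe-across-chord a n₁ refl refl n₃ e = not-≢ (stripe (a + a)) (sym (trans (sym (before n₁)) (trans e (after n₃))))
  where
  before : ∀ {p} → Nbr p a → stripe (suc a + lo p a) ≡ stripe (a + a)
  before {p} up rewrite lo-up p | +-suc p p = refl
  before dn rewrite lo-dn a = stripe-odd a
  after : ∀ {q} → Nbr (suc (suc a)) q → stripe (suc a + lo (suc (suc a)) q) ≡ not (stripe (a + a))
  after up rewrite lo-up (suc (suc a)) | +-suc a (suc a) | +-suc a a = cong not (stripe-odd a)
  after dn rewrite lo-dn (suc a) | +-suc a a = refl

stripe-with-chord : ∀ a {p₁ p₂ p₃ p₄} → Nbr p₁ p₂ → (Nbr p₂ p₃ ⊎ Chord a p₂ p₃) → Nbr p₃ p₄ →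
  ¬ p₁ ≡ p₃ → ¬ p₂ ≡ p₄ → ¬ stripe (suc a + lo p₁ p₂) ≡ stripe (suc a + lo p₃ p₄)
stripe-with-chord a n₁ (inj₁ n₂) n₃ p₁≢p₃ p₂≢p₄ = stripe-three-steps (suc a) n₁ n₂ n₃ p₁≢p₃ p₂≢p₄
stripe-with-chord a n₁ (inj₂ (inj₁ (e₂ , e₃))) n₃ _ _ = stripe-across-chord a n₁ e₂ e₃ n₃
stripe-with-chord a {p₁} {p₂} {p₃} {p₄} n₁ (inj₂ (inj₂ (e₂ , e₃))) n₃ _ _ e =
  stripe-across-chord a (nbr-sym n₃) e₃ e₂ (nbr-sym n₁)
    (trans (cong (λ t → stripe (suc a + t)) (lo-sym p₄ p₃))
      (trans (sym e) (cong (λ t → stripe (suc a + t)) (lo-sym p₁ p₂))))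

bit : ∀ {r} → Bool → Fin (suc (suc r))
bit false = zero
bit true = suc zero

bit-injective : ∀ {r} a b → bit {r} a ≡ bit b → a ≡ b
bit-injective false false _ = refl
bit-injective true true _ = refl
bit-injective false true ()
bit-injective true false ()

∧-true-l : ∀ {a b} → a ∧ b ≡ true → a ≡ true
∧-true-l {true} _ = refl

∧-true-r : ∀ {a b} → a ∧ b ≡ true → b ≡ true
∧-true-r {true} e = e

∧-true : ∀ {a b} → a ≡ true → b ≡ true → a ∧ b ≡ true
∧-true refl refl = refl

-- Every vertex gets a
-- position on W: the least j ≤ D with v j = x, or a number exceeding D if x is off W.
module Geodesic {G : Graph} (D : ℕ) {x₀ y₀ : Fin (n G)} (W : Walk G x₀ y₀ D)
                (shortest : ∀ l → Walk G x₀ y₀ l → D ≤ l) where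
  open Walks

  V : Set
  V = Fin (n G)

  v : ℕ → V
  v = vertex W

  step : ∀ j → j < D → Adj G (v j) (v (suc j))
  step = vertex-step W

  -- replacing the segment of W between v a and v b by a walk of length l is no shortcut
  forward-bound : ∀ a b l → a ≤ D → b ≤ D → Walk G (v a) (v b) l → b ≤ l + a
  forward-bound a b l a≤D b≤D w with b ≤? a
  ... | yes b≤a = ≤-trans b≤a (m≤n+m a l)
  ... | no _ = +-cancelʳ-≤ (D ∸ b) b (l + a) (begin
    b + (D ∸ b)        ≡⟨ m+[n∸m]≡n b≤D ⟩
    D                  ≤⟨ shortest _ (take W a a≤D ++ʷ (w ++ʷ drop W b b≤D)) ⟩
    a + (l + (D ∸ b))  ≡⟨ +-assoc a l (D ∸ b) ⟨
    a + l + (D ∸ b)    ≡⟨ cong (_+ (D ∸ b)) (+-comm a l) ⟩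
    l + a + (D ∸ b)    ∎)
    where open ≤-Reasoning

  backward-bound : ∀ a b l → a ≤ D → b ≤ D → Walk G (v a) (v b) l → a ≤ l + b
  backward-bound a b l a≤D b≤D w = forward-bound b a l b≤D a≤D (reverse w)

  v-injective : ∀ a b → a ≤ D → b ≤ D → v a ≡ v b → a ≡ b
  v-injective a b a≤D b≤D e = ≤-antisym (backward-bound a b 0 a≤D b≤D stay) (forward-bound a b 0 a≤D b≤D stay)
    where stay : Walk G (v a) (v b) 0
          stay = subst (λ q → Walk G (v a) q 0) e nil

  v-nbr : ∀ a b → a ≤ D → b ≤ D → Adj G (v a) (v b) → Nbr a b
  v-nbr a b a≤D b≤D e = mkNbr a b (forward-bound a b 1 a≤D b≤D (edge e)) (backward-bound a b 1 a≤D b≤D (edge e))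
    (λ a≡b → adjNeq G e (cong v a≡b))

  common-neighbour : ∀ a b w → a ≤ D → b ≤ D → Adj G (v a) w → Adj G w (v b) → b ≤ 2 + a
  common-neighbour a b w a≤D b≤D e f = forward-bound a b 2 a≤D b≤D (cons e (edge f))

  search : V → ℕ → ℕ
  search x zero with v 0 ≟F x
  ... | yes _ = 0
  ... | no _ = 1
  search x (suc k) with search x k ≤? k
  ... | yes _ = search x k
  ... | no _ with v (suc k) ≟F x
  ...   | yes _ = suc k
  ...   | no _ = suc (suc k)

  search-found : ∀ x k → search x k ≤ k → v (search x k) ≡ x
  search-found x zero h with v 0 ≟F x
  ... | yes e = e
  ... | no _ with h
  ...   | ()
  search-found x (suc k) h with search x k ≤? k
  ... | yes p = search-found x k p
  ... | no _ with v (suc k) ≟F x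
  ...   | yes e = e
  ...   | no _ = ⊥-elim (1+n≰n h)

  search-complete : ∀ x k j → j ≤ k → v j ≡ x → search x k ≤ k
  search-complete x zero zero _ e with v 0 ≟F x
  ... | yes _ = z≤n
  ... | no ne = ⊥-elim (ne e)
  search-complete x (suc k) j j≤k e with search x k ≤? k
  ... | yes p = ≤-trans p (n≤1+n k)
  ... | no np with v (suc k) ≟F x
  ...   | yes _ = ≤-refl
  ...   | no ne with m≤n⇒m<n∨m≡n j≤k
  ...     | inj₁ (s≤s j≤k′) = ⊥-elim (np (search-complete x k j j≤k′ e))
  ...     | inj₂ refl = ⊥-elim (ne e)

  pos : V → ℕ
  pos x = search x D

  onPath : V → Bool
  onPath x = pos x ≤ᵇ D

  onPath-pos : ∀ x → onPath x ≡ true → pos x ≤ D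
  onPath-pos x e = ≤ᵇ⇒≤ (pos x) D (subst T (sym e) tt)

  v-pos : ∀ x → pos x ≤ D → v (pos x) ≡ x
  v-pos x h = search-found x D h

  pos-v : ∀ j → j ≤ D → pos (v j) ≡ j
  pos-v j j≤D = v-injective _ _ found j≤D (v-pos (v j) found)
    where found = search-complete (v j) D j j≤D refl

  onPath-v : ∀ j → j ≤ D → onPath (v j) ≡ true
  onPath-v j j≤D = ≤⇒≤ᵇ′ (subst (_≤ D) (sym (pos-v j j≤D)) j≤D)
    where ≤⇒≤ᵇ′ : ∀ {p} → p ≤ D → (p ≤ᵇ D) ≡ true
          ≤⇒≤ᵇ′ {p} h with p ≤ᵇ D | ≤⇒≤ᵇ h
          ... | true | _ = refl

  onPath-v-pos : ∀ {x} → onPath x ≡ true → x ≡ v (pos x)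
  onPath-v-pos {x} o = sym (v-pos x (onPath-pos x o))

  offPath-≢ : ∀ x → onPath x ≡ false → ∀ j → j ≤ D → ¬ v j ≡ x
  offPath-≢ x off j j≤D refl with trans (sym off) (onPath-v j j≤D)
  ... | ()

  adj-pos : ∀ {x y} → onPath x ≡ true → onPath y ≡ true → Adj G x y → Nbr (pos x) (pos y)
  adj-pos {x} {y} ox oy a = v-nbr _ _ (onPath-pos x ox) (onPath-pos y oy)
    (subst₂ (Adj G) (onPath-v-pos ox) (onPath-v-pos oy) a)

  neq-pos : ∀ {x y} → onPath x ≡ true → onPath y ≡ true → ¬ x ≡ y → ¬ pos x ≡ pos y
  neq-pos {x} {y} ox oy x≢y e = x≢y (trans (onPath-v-pos ox) (trans (cong v e) (sym (onPath-v-pos oy))))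

  stripe-on-path : ∀ c {x y z u} → Consecutive G x y z u →
    onPath x ≡ true → onPath y ≡ true → onPath z ≡ true → onPath u ≡ true →
    ¬ stripe (c + lo (pos x) (pos y)) ≡ stripe (c + lo (pos z) (pos u))
  stripe-on-path c (a₁ , a₂ , a₃ , x≢z , y≢u) ox oy oz ou =
    stripe-three-steps c (adj-pos ox oy a₁) (adj-pos oy oz a₂) (adj-pos oz ou a₃) (neq-pos ox oz x≢z) (neq-pos oy ou y≢u)

-- The stripe colouring of the geodesic W: Q is the set of pairs of path vertices, the
-- listed edges are the D edges of W and the label of {x , y} is lo (pos x) (pos y), so
-- that edge t has label t.
module StripedGeodesic {G : Graph} (D : ℕ) {x₀ y₀ : Fin (n G)} (W : Walk G x₀ y₀ D)
                      (shortest : ∀ l → Walk G x₀ y₀ l → D ≤ l) where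
  open Geodesic D W shortest public

  bothOnPath : V → V → Bool
  bothOnPath x y = onPath x ∧ onPath y

  step-onPath : ∀ t → t < D → bothOnPath (v t) (v (suc t)) ≡ true
  step-onPath t t<D = ∧-true (onPath-v t (<⇒≤ t<D)) (onPath-v (suc t) t<D)

  step-label : ∀ t → t < D → lo (pos (v t)) (pos (v (suc t))) ≡ t
  step-label t t<D rewrite pos-v t (<⇒≤ t<D) | pos-v (suc t) t<D = lo-up t

  stripeColouring : PartialColouring G D 1
  stripeColouring = record
    { inQ = bothOnPath
    ; inQ-sym = λ x y → ∧-comm (onPath x) (onPath y)
    ; colour = λ x y → bit (stripe (lo (pos x) (pos y)))
    ; colour-sym = λ x y _ _ → cong (λ t → bit (stripe t)) (lo-sym (pos x) (pos y))
    ; colour-inj = λ x y z u c q₁ q₂ e →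
        stripe-on-path 0 c (∧-true-l q₁) (∧-true-r q₁) (∧-true-l q₂) (∧-true-r q₂) (bit-injective _ _ e)
    ; end₁ = v
    ; end₂ = λ t → v (suc t)
    ; listed-adj = step
    ; listed-inQ = step-onPath
    ; label = λ x y → lo (pos x) (pos y)
    ; label-sym = λ x y → lo-sym (pos x) (pos y)
    ; label-listed = step-label
    }

module OffPath {G : Graph} (D : ℕ) {x₀ y₀ : Fin (n G)} (W : Walk G x₀ y₀ D)
               (shortest : ∀ l → Walk G x₀ y₀ l → D ≤ l)
               (w : Fin (n G)) (w-off : Geodesic.onPath D W shortest w ≡ false) where
  open StripedGeodesic D W shortest public

  isW : V → Bool
  isW x = does (x ≟F w)

  isW-sound : ∀ x → isW x ≡ true → x ≡ w
  isW-sound x e with x ≟F w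
  ... | yes x≡w = x≡w

  isW-w : isW w ≡ true
  isW-w with w ≟F w
  ... | yes _ = refl
  ... | no w≢w = ⊥-elim (w≢w refl)

  isW-onPath : ∀ x → onPath x ≡ true → isW x ≡ false
  isW-onPath x o with x ≟F w
  ... | yes refl = ⊥-elim (true≢false (trans (sym o) w-off))
  ... | no _ = refl

  inPathW : V → Bool
  inPathW x = onPath x ∨ isW x

  inPathW-cases : ∀ x → inPathW x ≡ true → (onPath x ≡ true) ⊎ (x ≡ w)
  inPathW-cases x e with onPath x
  ... | true = inj₁ refl
  ... | false = inj₂ (isW-sound x e)

  inPathW-v : ∀ j → j ≤ D → inPathW (v j) ≡ true
  inPathW-v j j≤D rewrite onPath-v j j≤D = refl

  inPathW-w : inPathW w ≡ true
  inPathW-w rewrite w-off | isW-w = refl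

  bothOnPath-w : ∀ x → bothOnPath x w ≡ false
  bothOnPath-w x rewrite w-off = ∧-comm (onPath x) false

  w-far : D < pos w
  w-far with pos w ≤? D
  ... | yes h = ⊥-elim (offPath-≢ w w-off (pos w) h (v-pos w h))
  ... | no h = ≰⇒> h

  AtW : V → V → V → Set
  AtW p x y = (x ≡ w × y ≡ p) ⊎ (x ≡ p × y ≡ w)

  atW-same : ∀ {x y z u p} → Consecutive G x y z u → AtW p x y → AtW p z u → ⊥
  atW-same c (inj₁ (refl , refl)) (inj₁ (refl , refl)) = consecutive-distinct G c (inj₁ (refl , refl))
  atW-same c (inj₁ (refl , refl)) (inj₂ (refl , refl)) = consecutive-distinct G c (inj₂ (refl , refl))
  atW-same c (inj₂ (refl , refl)) (inj₁ (refl , refl)) = consecutive-distinct G c (inj₂ (refl , refl))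
  atW-same c (inj₂ (refl , refl)) (inj₂ (refl , refl)) = consecutive-distinct G c (inj₁ (refl , refl))

  atW-middle : ∀ {x y z u p q} → Consecutive G x y z u → AtW p x y → AtW q z u → Adj G p q
  atW-middle (_ , _ , _ , x≢z , _) (inj₁ (refl , refl)) (inj₁ (refl , refl)) = ⊥-elim (x≢z refl)
  atW-middle (_ , a₂ , _ , _ , _) (inj₁ (refl , refl)) (inj₂ (refl , refl)) = a₂
  atW-middle (_ , a₂ , _ , _ , _) (inj₂ (refl , refl)) (inj₁ (refl , refl)) = ⊥-elim (adjNeq G a₂ refl)
  atW-middle (_ , _ , _ , _ , y≢u) (inj₂ (refl , refl)) (inj₂ (refl , refl)) = ⊥-elim (y≢u refl)

  append : (ℕ → V) → (ℕ → V) → ℕ → V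
  append f g t = if t <ᵇ D then f t else g (t ∸ D)

  append-path : ∀ {f g t} → t < D → append f g t ≡ f t
  append-path {t = t} t<D with t <ᵇ D | <⇒<ᵇ t<D
  ... | true | _ = refl

  append-extra : ∀ {f g} s → append f g (D + s) ≡ g s
  append-extra {f} {g} s with D + s <ᵇ D in e
  ... | true = ⊥-elim (m+n≮m D s (<ᵇ⇒< (D + s) D (subst T (sym e) tt)))
  ... | false = cong g (m+n∸m≡n D s)

  index-cases : ∀ {t k} → t < D + k → (t < D) ⊎ (Σ ℕ λ s → (s < k) × (t ≡ D + s))
  index-cases {t} {k} t<D+k with t <? D
  ... | yes t<D = inj₁ t<D
  ... | no t≮D = inj₂ (t ∸ D , +-cancelˡ-< D _ _ (subst (_< D + k) (sym (m+[n∸m]≡n (≮⇒≥ t≮D))) t<D+k) ,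
                      sym (m+[n∸m]≡n (≮⇒≥ t≮D)))

  append-all : ∀ {k} (g₁ g₂ : ℕ → V) (P : ℕ → V → V → Set) →
    (∀ t → t < D → P t (v t) (v (suc t))) → (∀ s → s < k → P (D + s) (g₁ s) (g₂ s)) →
    ∀ t → t < D + k → P t (append v g₁ t) (append (λ t → v (suc t)) g₂ t)
  append-all g₁ g₂ P path extra t t<L with index-cases t<L
  ... | inj₁ t<D rewrite append-path {v} {g₁} t<D | append-path {λ t → v (suc t)} {g₂} t<D = path t t<D
  ... | inj₂ (s , s<k , refl) rewrite append-extra {v} {g₁} s | append-extra {λ t → v (suc t)} {g₂} s = extra s s<k

  -- Add the pendant edge
  -- {v i , w}, colour it `true` and shift the stripes so that the path edges two steps
  -- away from v i are `false`: two colours for D + 1 edges.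
  module Pendant (i : ℕ) (i≤D : i ≤ D) (vi~w : Adj G (v i) w)
                 (unique : ∀ j → j ≤ D → Adj G w (v j) → j ≡ i) where

    -- the shift 3(i+1) makes the lower ends i−2 and i+1 land on 4i+1 and 4(i+1)
    shift : ℕ
    shift = suc i * 3

    inQ : V → V → Bool
    inQ x y = inPathW x ∧ inPathW y

    colourOf : Bool → ℕ → Bool
    colourOf true m = stripe (shift + m)
    colourOf false m = true

    colour : V → V → Fin 2
    colour x y = bit (colourOf (bothOnPath x y) (lo (pos x) (pos y)))

    colour-sym : ∀ x y → colour x y ≡ colour y x
    colour-sym x y = cong₂ (λ b m → bit (colourOf b m)) (∧-comm (onPath x) (onPath y)) (lo-sym (pos x) (pos y))

    colour-path : ∀ x y → bothOnPath x y ≡ true → colour x y ≡ bit (stripe (shift + lo (pos x) (pos y)))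
    colour-path x y e rewrite e = refl

    colour-pendant : colour (v i) w ≡ bit true
    colour-pendant rewrite bothOnPath-w (v i) = refl

    neighbour-v : ∀ y → onPath y ≡ true → Adj G y w → y ≡ v i
    neighbour-v y o a = trans (onPath-v-pos o)
      (cong v (unique (pos y) (onPath-pos y o) (adjSym G (subst (λ q → Adj G q w) (onPath-v-pos o) a))))

    edge-cases : ∀ x y → Adj G x y → inQ x y ≡ true →
      (onPath x ≡ true × onPath y ≡ true) ⊎ AtW (v i) x y
    edge-cases x y a q with inPathW-cases x (∧-true-l q) | inPathW-cases y (∧-true-r q)
    ... | inj₁ ox | inj₁ oy = inj₁ (ox , oy)
    ... | inj₁ ox | inj₂ refl = inj₂ (inj₂ (neighbour-v x ox a , refl))
    ... | inj₂ refl | inj₁ oy = inj₂ (inj₁ (refl , neighbour-v y oy (adjSym G a)))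
    ... | inj₂ refl | inj₂ refl = ⊥-elim (adjNeq G a refl)

    -- path edges two steps from v i have lower end i − 2 or i + 1, hence stripe false
    stripe-near-i : ∀ {p q} → Nbr p q → Nbr q i → ¬ p ≡ i → stripe (shift + lo p q) ≡ false
    stripe-near-i {p} up up _ rewrite lo-up p = trans (cong stripe (shift≡ p)) (stripe-4m+1 (suc (suc p)))
      where shift≡ : ∀ p → suc (suc (suc p)) * 3 + p ≡ suc (suc (suc p) * 4)
            shift≡ = solve-∀
    stripe-near-i up dn p≢i = ⊥-elim (p≢i refl)
    stripe-near-i dn up p≢i = ⊥-elim (p≢i refl)
    stripe-near-i {q = q} dn dn _ rewrite lo-dn q = trans (cong stripe (shift≡ i)) (stripe-4m (suc i))
      where shift≡ : ∀ p → suc p * 3 + suc p ≡ suc p * 4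
            shift≡ = solve-∀

    separates-from-path : ∀ x y z u → Consecutive G x y z u → onPath x ≡ true → onPath y ≡ true →
      inQ z u ≡ true → ¬ colour x y ≡ colour z u
    separates-from-path x y z u c@(a₁ , a₂ , a₃ , x≢z , y≢u) ox oy q e with edge-cases z u a₃ q
    ... | inj₁ (oz , ou) = stripe-on-path shift c ox oy oz ou
           (bit-injective _ _ (trans (sym (colour-path x y (∧-true ox oy))) (trans e (colour-path z u (∧-true oz ou)))))
    ... | inj₂ (inj₁ (refl , refl)) = y≢u (neighbour-v y oy a₂)
    ... | inj₂ (inj₂ (refl , refl)) = true≢false (sym (trans (sym (stripe-near-i
              (adj-pos ox oy a₁) (subst (Nbr (pos y)) (pos-v i i≤D) (adj-pos oy (onPath-v i i≤D) a₂))
              (λ h → x≢z (trans (onPath-v-pos ox) (cong v h)))))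
            (bit-injective _ _ (trans (sym (colour-path x y (∧-true ox oy))) (trans e colour-pendant)))))

    -- the pendant edge cannot be both end edges, so one end edge is a path edge
    separates : ∀ x y z u → Consecutive G x y z u → inQ x y ≡ true → inQ z u ≡ true → ¬ colour x y ≡ colour z u
    separates x y z u c q₁ q₂ e with edge-cases x y (proj₁ c) q₁
    ... | inj₁ (ox , oy) = separates-from-path x y z u c ox oy q₂ e
    ... | inj₂ at-xy with edge-cases z u (proj₁ (proj₂ (proj₂ c))) q₂
    ...   | inj₁ (oz , ou) = separates-from-path u z y x (consecutive-reverse G c) ou oz
              (trans (∧-comm (inPathW y) (inPathW x)) q₁) (trans (colour-sym u z) (trans (sym e) (colour-sym x y)))
    ...   | inj₂ at-zu = atW-same c at-xy at-zu

    label : V → V → ℕ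
    label x y = if bothOnPath x y then lo (pos x) (pos y) else D + 0

    label-path : ∀ x y → bothOnPath x y ≡ true → label x y ≡ lo (pos x) (pos y)
    label-path x y e rewrite e = refl

    label-pendant : ∀ s → s < 1 → label (v i) w ≡ D + s
    label-pendant zero _ rewrite bothOnPath-w (v i) = refl
    label-pendant (suc _) (s≤s ())

    certificate : PartialColouring G (D + 1) 1
    certificate = record
      { inQ = inQ
      ; inQ-sym = λ x y → ∧-comm (inPathW x) (inPathW y)
      ; colour = colour
      ; colour-sym = λ x y _ _ → colour-sym x y
      ; colour-inj = separates
      ; end₁ = append v (λ _ → v i)
      ; end₂ = append (λ t → v (suc t)) (λ _ → w)
      ; listed-adj = append-all _ _ (λ _ → Adj G) step (λ _ _ → vi~w)
      ; listed-inQ = append-all _ _ (λ _ x y → inQ x y ≡ true)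
          (λ t t<D → ∧-true (inPathW-v t (<⇒≤ t<D)) (inPathW-v (suc t) t<D))
          (λ _ _ → ∧-true (inPathW-v i i≤D) inPathW-w)
      ; label = label
      ; label-sym = λ x y → cong₂ (λ b m → if b then m else D + 0) (∧-comm (onPath x) (onPath y)) (lo-sym (pos x) (pos y))
      ; label-listed = append-all _ _ (λ t x y → label x y ≡ t)
          (λ t t<D → trans (label-path _ _ (step-onPath t t<D)) (step-label t t<D))
          label-pendant
      }

  -- Add the two edges {v a , w} and
  -- {w , v (a+2)} with a third colour: they are never end edges of one consecutive
  -- triple, since a and a+2 are not neighbours.  Three colours for D + 2 edges.
  module Detour (a : ℕ) (a+2≤D : suc (suc a) ≤ D) (va~w : Adj G (v a) w) (w~va+2 : Adj G w (v (suc (suc a)))) where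

    Attach : ℕ → Set
    Attach t = (t ≡ a) ⊎ (t ≡ suc (suc a))

    attach? : V → Bool
    attach? y = onPath y ∧ ((pos y ≡ᵇ a) ∨ (pos y ≡ᵇ suc (suc a)))

    attach?-sound : ∀ y → attach? y ≡ true → Σ ℕ λ t → (y ≡ v t) × Attach t
    attach?-sound y e = pos y , onPath-v-pos (∧-true-l e) , which (∧-true-r e)
      where which : ((pos y ≡ᵇ a) ∨ (pos y ≡ᵇ suc (suc a))) ≡ true → Attach (pos y)
            which h with pos y ≡ᵇ a in e₁
            ... | true = inj₁ (≡ᵇ⇒≡ (pos y) a (subst T (sym e₁) tt))
            ... | false = inj₂ (≡ᵇ⇒≡ (pos y) (suc (suc a)) (subst T (sym h) tt))

    attach-≤ : ∀ {t} → Attach t → t ≤ D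
    attach-≤ (inj₁ refl) = ≤-trans (n≤1+n a) (≤-trans (n≤1+n (suc a)) a+2≤D)
    attach-≤ (inj₂ refl) = a+2≤D

    attach-not-nbr : ∀ {s t} → Attach s → Attach t → ¬ Nbr s t
    attach-not-nbr (inj₁ refl) (inj₁ refl) nb = nbr-≢ nb refl
    attach-not-nbr (inj₂ refl) (inj₂ refl) nb = nbr-≢ nb refl
    attach-not-nbr (inj₁ refl) (inj₂ refl) ()
    attach-not-nbr (inj₂ refl) (inj₁ refl) ()

    attach?-v : ∀ t → Attach t → attach? (v t) ≡ true
    attach?-v t at rewrite onPath-v t (attach-≤ at) | pos-v t (attach-≤ at) = which at
      where which : ∀ {t} → Attach t → ((t ≡ᵇ a) ∨ (t ≡ᵇ suc (suc a))) ≡ true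
            which (inj₁ refl) rewrite ≡ᵇ-refl a = refl
            which (inj₂ refl) rewrite ≡ᵇ-refl a = ∨-comm _ true

    inQ : V → V → Bool
    inQ x y = bothOnPath x y ∨ ((isW x ∧ attach? y) ∨ (isW y ∧ attach? x))

    inQ-sym : ∀ x y → inQ x y ≡ inQ y x
    inQ-sym x y rewrite ∧-comm (onPath x) (onPath y) =
      cong (bothOnPath y x ∨_) (∨-comm (isW x ∧ attach? y) (isW y ∧ attach? x))

    inQ-path : ∀ x y → bothOnPath x y ≡ true → inQ x y ≡ true
    inQ-path x y e rewrite e = refl

    inQ-attached : ∀ t → Attach t → inQ (v t) w ≡ true
    inQ-attached t at rewrite attach?-v t at | isW-w = ∨-true (bothOnPath (v t) w) (isW (v t) ∧ attach? w)
      where ∨-true : ∀ b c → b ∨ (c ∨ true) ≡ true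
            ∨-true true c = refl
            ∨-true false true = refl
            ∨-true false false = refl

    added-edge : ∀ x y → inQ x y ≡ true → bothOnPath x y ≡ false → Σ ℕ λ t → AtW (v t) x y × Attach t
    added-edge x y q off rewrite off with isW x ∧ attach? y in e
    ... | true with attach?-sound y (∧-true-r {isW x} e)
    ...   | t , refl , at = t , inj₁ (isW-sound x (∧-true-l {isW x} e) , refl) , at
    added-edge x y q off | false with attach?-sound x (∧-true-r {isW y} q)
    ...   | t , refl , at = t , inj₂ (refl , isW-sound y (∧-true-l {isW y} q)) , at

    third : Fin 3
    third = suc (suc zero)

    bit≢third : ∀ b → ¬ bit b ≡ third
    bit≢third false ()
    bit≢third true ()

    colour : V → V → Fin 3
    colour x y = if bothOnPath x y then bit (stripe (lo (pos x) (pos y))) else third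

    colour-sym : ∀ x y → colour x y ≡ colour y x
    colour-sym x y = cong₂ (λ b m → if b then bit (stripe m) else third) (∧-comm (onPath x) (onPath y)) (lo-sym (pos x) (pos y))

    colour-path : ∀ x y → bothOnPath x y ≡ true → colour x y ≡ bit (stripe (lo (pos x) (pos y)))
    colour-path x y e rewrite e = refl

    colour-added : ∀ x y → bothOnPath x y ≡ false → colour x y ≡ third
    colour-added x y e rewrite e = refl

    -- two added end edges would make a and a+2 neighbours on W
    separates : ∀ x y z u → Consecutive G x y z u → inQ x y ≡ true → inQ z u ≡ true → ¬ colour x y ≡ colour z u
    separates x y z u c q₁ q₂ e = by-cases (bothOnPath x y) refl (bothOnPath z u) refl
      where
      by-cases : ∀ b₁ → bothOnPath x y ≡ b₁ → ∀ b₂ → bothOnPath z u ≡ b₂ → ⊥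
      by-cases true p₁ true p₂ = stripe-on-path 0 c (∧-true-l p₁) (∧-true-r p₁) (∧-true-l p₂) (∧-true-r p₂)
        (bit-injective _ _ (trans (sym (colour-path x y p₁)) (trans e (colour-path z u p₂))))
      by-cases true p₁ false p₂ = bit≢third _ (trans (sym (colour-path x y p₁)) (trans e (colour-added z u p₂)))
      by-cases false p₁ true p₂ = bit≢third _ (trans (sym (colour-path z u p₂)) (trans (sym e) (colour-added x y p₁)))
      by-cases false p₁ false p₂ with added-edge x y q₁ p₁ | added-edge z u q₂ p₂
      ... | s , at-xy , as | t , at-zu , at =
        attach-not-nbr as at (v-nbr s t (attach-≤ as) (attach-≤ at) (atW-middle c at-xy at-zu))

    label : V → V → ℕ
    label x y = if bothOnPath x y then lo (pos x) (pos y) else D + (if lo (pos x) (pos y) ≡ᵇ a then 0 else 1)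

    label-path : ∀ x y → bothOnPath x y ≡ true → label x y ≡ lo (pos x) (pos y)
    label-path x y e rewrite e = refl

    lo-w : ∀ t → t ≤ D → lo (pos (v t)) (pos w) ≡ t
    lo-w t t≤D rewrite pos-v t t≤D = m≤n⇒m⊓n≡m (≤-trans t≤D (<⇒≤ w-far))

    attachment : ℕ → V
    attachment zero = v a
    attachment (suc _) = v (suc (suc a))

    a+2≢ᵇa : ∀ m → (suc (suc m) ≡ᵇ m) ≡ false
    a+2≢ᵇa zero = refl
    a+2≢ᵇa (suc m) = a+2≢ᵇa m

    label-added : ∀ s → s < 2 → label (attachment s) w ≡ D + s
    label-added zero _ rewrite bothOnPath-w (v a) | lo-w a (attach-≤ (inj₁ refl)) | ≡ᵇ-refl a = refl
    label-added (suc zero) _ rewrite bothOnPath-w (v (suc (suc a))) | lo-w (suc (suc a)) a+2≤D | a+2≢ᵇa a = refl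
    label-added (suc (suc _)) (s≤s (s≤s ()))

    certificate : PartialColouring G (D + 2) 2
    certificate = record
      { inQ = inQ
      ; inQ-sym = inQ-sym
      ; colour = colour
      ; colour-sym = λ x y _ _ → colour-sym x y
      ; colour-inj = separates
      ; end₁ = append v attachment
      ; end₂ = append (λ t → v (suc t)) (λ _ → w)
      ; listed-adj = append-all _ _ (λ _ → Adj G) step added-adj
      ; listed-inQ = append-all _ _ (λ _ x y → inQ x y ≡ true)
          (λ t t<D → inQ-path _ _ (step-onPath t t<D)) added-inQ
      ; label = label
      ; label-sym = λ x y → cong₂ (λ b m → if b then m else D + (if m ≡ᵇ a then 0 else 1))
                                  (∧-comm (onPath x) (onPath y)) (lo-sym (pos x) (pos y))
      ; label-listed = append-all _ _ (λ t x y → label x y ≡ t)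
          (λ t t<D → trans (label-path _ _ (step-onPath t t<D)) (step-label t t<D)) label-added
      }
      where
      added-adj : ∀ s → s < 2 → Adj G (attachment s) w
      added-adj zero _ = va~w
      added-adj (suc _) _ = adjSym G w~va+2
      added-inQ : ∀ s → s < 2 → inQ (attachment s) w ≡ true
      added-inQ zero _ = inQ-attached a (inj₁ refl)
      added-inQ (suc _) _ = inQ-attached (suc (suc a)) (inj₂ refl)

  -- Then
  -- v 0 … v a, w, v (a+1) … v D is a path of length D + 1 whose only chord is
  -- {v a , v (a+1)}, at new positions a and a+2; the stripe colouring shifted by a+1
  -- still separates all its consecutive triples.  Two colours for D + 1 edges.
  module Triangle (a : ℕ) (a<D : suc a ≤ D) (va~w : Adj G (v a) w) (w~va+1 : Adj G w (v (suc a)))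
                  (only : ∀ j → j ≤ D → Adj G w (v j) → (j ≡ a) ⊎ (j ≡ suc a)) where

    a≤D : a ≤ D
    a≤D = ≤-trans (n≤1+n a) a<D

    -- old positions after a move up by one to make room for w
    shift : ℕ → ℕ
    shift p with p ≤? a
    ... | yes _ = p
    ... | no _ = suc p

    shift-low : ∀ p → p ≤ a → shift p ≡ p
    shift-low p h with p ≤? a
    ... | yes _ = refl
    ... | no nh = ⊥-elim (nh h)

    shift-high : ∀ p → a < p → shift p ≡ suc p
    shift-high p h with p ≤? a
    ... | yes h′ = ⊥-elim (<⇒≱ h h′)
    ... | no _ = refl

    shift-injective : ∀ p q → shift p ≡ shift q → p ≡ q
    shift-injective p q e with p ≤? a | q ≤? a
    ... | yes _ | yes _ = e
    ... | no _ | no _ = suc-injective e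
    ... | yes hp | no hq = ⊥-elim (<⇒≱ (subst (a <_) (sym e) (≤-trans (≰⇒> hq) (n≤1+n q))) hp)
    ... | no hp | yes hq = ⊥-elim (<⇒≱ (subst (a <_) e (≤-trans (≰⇒> hp) (n≤1+n p))) hq)

    shift-≢ : ∀ p → ¬ shift p ≡ suc a
    shift-≢ p e with p ≤? a
    ... | yes h = <⇒≢ (s≤s h) e
    ... | no h = <⇒≢ (≰⇒> h) (sym (suc-injective e))

    pos′ : V → ℕ
    pos′ x = if isW x then suc a else shift (pos x)

    pos′-w : pos′ w ≡ suc a
    pos′-w rewrite isW-w = refl

    pos′-path : ∀ x → onPath x ≡ true → pos′ x ≡ shift (pos x)
    pos′-path x o rewrite isW-onPath x o = refl

    pos′-injective : ∀ x y → inPathW x ≡ true → inPathW y ≡ true → ¬ x ≡ y → ¬ pos′ x ≡ pos′ y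
    pos′-injective x y ox oy x≢y e with inPathW-cases x ox | inPathW-cases y oy
    ... | inj₂ refl | inj₂ refl = x≢y refl
    ... | inj₂ refl | inj₁ py = shift-≢ (pos y) (sym (trans (sym pos′-w) (trans e (pos′-path y py))))
    ... | inj₁ px | inj₂ refl = shift-≢ (pos x) (trans (sym (pos′-path x px)) (trans e pos′-w))
    ... | inj₁ px | inj₁ py = neq-pos px py x≢y (shift-injective _ _ (trans (sym (pos′-path x px)) (trans e (pos′-path y py))))

    shift-step : ∀ {p q} → Nbr p q → Nbr (shift p) (shift q) ⊎ Chord a (shift p) (shift q)
    shift-step {p} up with <-cmp p a
    ... | tri> _ _ h rewrite shift-high p h | shift-high (suc p) (≤-trans h (n≤1+n p)) = inj₁ up
    ... | tri< h _ _ rewrite shift-low p (<⇒≤ h) | shift-low (suc p) h = inj₁ up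
    ... | tri≈ _ refl _ rewrite shift-low p ≤-refl | shift-high (suc p) ≤-refl = inj₂ (inj₁ (refl , refl))
    shift-step {q = q} dn with <-cmp q a
    ... | tri> _ _ h rewrite shift-high q h | shift-high (suc q) (≤-trans h (n≤1+n q)) = inj₁ dn
    ... | tri< h _ _ rewrite shift-low q (<⇒≤ h) | shift-low (suc q) h = inj₁ dn
    ... | tri≈ _ refl _ rewrite shift-low q ≤-refl | shift-high (suc q) ≤-refl = inj₂ (inj₂ (refl , refl))

    edge-shape : ∀ x y → inPathW x ≡ true → inPathW y ≡ true → Adj G x y →
      Nbr (pos′ x) (pos′ y) ⊎ Chord a (pos′ x) (pos′ y)
    edge-shape x y ox oy e with inPathW-cases x ox | inPathW-cases y oy
    ... | inj₂ refl | inj₂ refl = ⊥-elim (adjNeq G e refl)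
    ... | inj₂ refl | inj₁ py rewrite pos′-w | pos′-path y py
          with only (pos y) (onPath-pos y py) (subst (Adj G w) (onPath-v-pos py) e)
    ...   | inj₁ h rewrite h | shift-low a ≤-refl = inj₁ dn
    ...   | inj₂ h rewrite h | shift-high (suc a) ≤-refl = inj₁ up
    edge-shape x y ox oy e | inj₁ px | inj₂ refl rewrite pos′-w | pos′-path x px
          with only (pos x) (onPath-pos x px) (adjSym G (subst (λ q → Adj G q w) (onPath-v-pos px) e))
    ...   | inj₁ h rewrite h | shift-low a ≤-refl = inj₁ up
    ...   | inj₂ h rewrite h | shift-high (suc a) ≤-refl = inj₁ dn
    edge-shape x y ox oy e | inj₁ px | inj₁ py rewrite pos′-path x px | pos′-path y py = shift-step (adj-pos px py e)

    inQ : V → V → Bool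
    inQ x y = (inPathW x ∧ inPathW y) ∧ nbrᵇ (pos′ x) (pos′ y)

    colour : V → V → Fin 2
    colour x y = bit (stripe (suc a + lo (pos′ x) (pos′ y)))

    separates : ∀ x y z u → Consecutive G x y z u → inQ x y ≡ true → inQ z u ≡ true → ¬ colour x y ≡ colour z u
    separates x y z u (a₁ , a₂ , a₃ , x≢z , y≢u) q₁ q₂ e =
      stripe-with-chord a (nbrᵇ-sound _ _ (∧-true-r {inPathW x ∧ inPathW y} q₁)) (edge-shape y z oy oz a₂)
        (nbrᵇ-sound _ _ (∧-true-r {inPathW z ∧ inPathW u} q₂))
        (pos′-injective x z ox oz x≢z) (pos′-injective y u oy ou y≢u) (bit-injective _ _ e)
      where
      ox = ∧-true-l {inPathW x} (∧-true-l {inPathW x ∧ inPathW y} q₁)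
      oy = ∧-true-r {inPathW x} (∧-true-l {inPathW x ∧ inPathW y} q₁)
      oz = ∧-true-l {inPathW z} (∧-true-l {inPathW z ∧ inPathW u} q₂)
      ou = ∧-true-r {inPathW z} (∧-true-l {inPathW z ∧ inPathW u} q₂)

    v′ : ℕ → V
    v′ j with j ≤? a
    ... | yes _ = v j
    ... | no _ with j ≟ suc a
    ...   | yes _ = w
    ...   | no _ = v (pred j)

    data V′View (j : ℕ) : Set where
      before : j ≤ a → v′ j ≡ v j → V′View j
      middle : j ≡ suc a → v′ j ≡ w → V′View j
      after : suc a < j → v′ j ≡ v (pred j) → V′View j

    v′-before : ∀ j → j ≤ a → v′ j ≡ v j
    v′-before j h with j ≤? a
    ... | yes _ = refl
    ... | no nh = ⊥-elim (nh h)

    v′-middle : v′ (suc a) ≡ w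
    v′-middle with suc a ≤? a
    ... | yes h = ⊥-elim (1+n≰n h)
    ... | no _ with suc a ≟ suc a
    ...   | yes _ = refl
    ...   | no ne = ⊥-elim (ne refl)

    v′-after : ∀ j → suc a < j → v′ j ≡ v (pred j)
    v′-after j h with j ≤? a
    ... | yes h′ = ⊥-elim (<⇒≱ (≤-trans (n≤1+n (suc a)) h) h′)
    ... | no _ with j ≟ suc a
    ...   | yes e = ⊥-elim (<⇒≢ h (sym e))
    ...   | no _ = refl

    v′-view : ∀ j → V′View j
    v′-view j with <-cmp j (suc a)
    ... | tri< h _ _ = before (≤-pred h) (v′-before j (≤-pred h))
    ... | tri≈ _ refl _ = middle refl v′-middle
    ... | tri> _ _ h = after h (v′-after j h)

    suc-pred-pos : ∀ j → 0 < j → suc (pred j) ≡ j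
    suc-pred-pos (suc j) _ = refl

    v′-in : ∀ j → j ≤ suc D → (inPathW (v′ j) ≡ true) × (pos′ (v′ j) ≡ j)
    v′-in j j≤D+1 with v′-view j
    ... | before h e rewrite e = inPathW-v j (≤-trans h a≤D) ,
          trans (pos′-path (v j) (onPath-v j (≤-trans h a≤D))) (trans (cong shift (pos-v j (≤-trans h a≤D))) (shift-low j h))
    ... | middle refl e rewrite e = inPathW-w , pos′-w
    ... | after h e rewrite e = inPathW-v (pred j) pj≤D ,
            trans (pos′-path (v (pred j)) (onPath-v (pred j) pj≤D)) (trans (cong shift (pos-v (pred j) pj≤D))
               (trans (shift-high (pred j) (pred-mono-≤ h)) (suc-pred-pos j (≤-trans (s≤s z≤n) h))))
      where pj≤D : pred j ≤ D
            pj≤D = pred-mono-≤ j≤D+1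

    v′-step : ∀ t → t ≤ D → Adj G (v′ t) (v′ (suc t))
    v′-step t t≤D with v′-view t | v′-view (suc t)
    ... | before _ e | before h e′ rewrite e | e′ = step t (≤-trans h a≤D)
    ... | before _ e | middle h e′ rewrite e | e′ | suc-injective h = va~w
    ... | before h _ | after h′ _ = ⊥-elim (<⇒≱ h′ (s≤s h))
    ... | middle h _ | before h′ _ = ⊥-elim (1+n≰n (≤-trans (n≤1+n (suc a)) (subst (λ q → suc q ≤ a) h h′)))
    ... | middle h _ | middle h′ _ = ⊥-elim (1+n≢n (trans h′ (sym h)))
    ... | middle refl e | after _ e′ rewrite e | e′ = w~va+1
    ... | after h _ | before h′ _ = ⊥-elim (<⇒≱ (≤-trans h (n≤1+n t)) (≤-trans h′ (n≤1+n a)))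
    ... | after h _ | middle h′ _ = ⊥-elim (1+n≰n (≤-trans (n≤1+n (suc a)) (subst (suc (suc a) ≤_) (suc-injective h′) h)))
    ... | after h e | after _ e′ rewrite e | e′ =
          subst (λ q → Adj G (v (pred t)) (v q)) (suc-pred-pos t (≤-trans (s≤s z≤n) h))
            (step (pred t) (subst (_≤ D) (sym (suc-pred-pos t (≤-trans (s≤s z≤n) h))) t≤D))

    certificate : PartialColouring G (D + 1) 1
    certificate = record
      { inQ = inQ
      ; inQ-sym = λ x y → cong₂ _∧_ (∧-comm (inPathW x) (inPathW y)) (∨-comm (suc (pos′ x) ≡ᵇ pos′ y) _)
      ; colour = colour
      ; colour-sym = λ x y _ _ → cong (λ m → bit (stripe (suc a + m))) (lo-sym (pos′ x) (pos′ y))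
      ; colour-inj = separates
      ; end₁ = v′
      ; end₂ = λ t → v′ (suc t)
      ; listed-adj = λ t t<L → v′-step t (≤-pred (subst (t <_) (+-comm D 1) t<L))
      ; listed-inQ = listed-inQ
      ; label = λ x y → lo (pos′ x) (pos′ y)
      ; label-sym = λ x y → lo-sym (pos′ x) (pos′ y)
      ; label-listed = label-listed
      }
      where
      bound : ∀ {t} → t < D + 1 → t < suc D
      bound {t} = subst (t <_) (+-comm D 1)
      listed-inQ : ∀ t → t < D + 1 → inQ (v′ t) (v′ (suc t)) ≡ true
      listed-inQ t t<L with v′-in t (≤-trans (≤-pred (bound t<L)) (n≤1+n D)) | v′-in (suc t) (bound t<L)
      ... | in₁ , p₁ | in₂ , p₂ rewrite p₁ | p₂ = ∧-true (∧-true in₁ in₂) (nbrᵇ-complete {t} {suc t} up)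
      label-listed : ∀ t → t < D + 1 → lo (pos′ (v′ t)) (pos′ (v′ (suc t))) ≡ t
      label-listed t t<L rewrite proj₂ (v′-in t (≤-trans (≤-pred (bound t<L)) (n≤1+n D)))
                               | proj₂ (v′-in (suc t) (bound t<L)) = lo-up t

-- A graph isomorphic to the path P_{m+1}: its diameter is m, and for m ≥ 3 it needs
-- two colours, as its first three edges are consecutive.
module PathGraph (G : Graph) (m : ℕ) (f : Fin (n G) ↔ Fin (suc m))
                 (f-adj : ∀ x y → adj G x y ≡ pathAdj m (Inverse.to f x) (Inverse.to f y)) where
  open Walks

  p : Fin (n G) → ℕ
  p x = toℕ (Inverse.to f x)

  p≤m : ∀ x → p x ≤ m
  p≤m x = ≤-pred (toℕ<n (Inverse.to f x))

  adj-nbr : ∀ {x y} → Adj G x y → Nbr (p x) (p y)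
  adj-nbr {x} {y} a = nbrᵇ-sound (p x) (p y) (trans (sym (f-adj x y)) a)

  nbr-adj : ∀ {x y} → Nbr (p x) (p y) → Adj G x y
  nbr-adj {x} {y} nb = trans (f-adj x y) (nbrᵇ-complete nb)

  walk-length : ∀ {x y l} → Walk G x y l → p y ≤ l + p x
  walk-length nil = ≤-refl
  walk-length (cons a w) = ≤-trans (walk-length w) (one-step (adj-nbr a))
    where one-step : ∀ {a b l} → Nbr a b → l + b ≤ suc l + a
          one-step {a} {l = l} up = ≤-reflexive (+-suc l a)
          one-step {b = b} {l = l} dn = ≤-trans (+-monoʳ-≤ l (n≤1+n b)) (n≤1+n (l + suc b))

  clamp : ℕ → Fin (suc m)
  clamp j with j ≤? m
  ... | yes h = fromℕ< (s≤s h)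
  ... | no _ = fromℕ m

  toℕ-clamp : ∀ j → j ≤ m → toℕ (clamp j) ≡ j
  toℕ-clamp j h with j ≤? m
  ... | yes h′ = toℕ-fromℕ< (s≤s h′)
  ... | no nh = ⊥-elim (nh h)

  at : ℕ → Fin (n G)
  at j = Inverse.from f (clamp j)

  p-at : ∀ j → j ≤ m → p (at j) ≡ j
  p-at j h = trans (cong toℕ (Inverse.strictlyInverseˡ f (clamp j))) (toℕ-clamp j h)

  at-p : ∀ x → at (p x) ≡ x
  at-p x = trans (cong (Inverse.from f) (toℕ-injective (toℕ-clamp (p x) (p≤m x))))
    (Inverse.strictlyInverseʳ f x)

  at-step : ∀ j → j < m → Adj G (at j) (at (suc j))
  at-step j h = nbr-adj (subst₂ Nbr (sym (p-at j (<⇒≤ h))) (sym (p-at (suc j) h)) up)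

  walk-up : ∀ a d → a + d ≤ m → Walk G (at a) (at (a + d)) d
  walk-up a zero h = subst (λ q → Walk G (at a) (at q) 0) (sym (+-identityʳ a)) nil
  walk-up a (suc d) h = cons (at-step a (≤-trans (s≤s (m≤m+n a d)) h′))
      (subst (λ q → Walk G (at (suc a)) (at q) d) (sym (+-suc a d)) (walk-up (suc a) d h′))
    where h′ = subst (_≤ m) (+-suc a d) h

  walk-between : ∀ x y → p x ≤ p y → Walk G x y (p y ∸ p x)
  walk-between x y h = subst₂ (λ a b → Walk G a b (p y ∸ p x)) (at-p x)
    (trans (cong at (m+[n∸m]≡n h)) (at-p y))
    (walk-up (p x) (p y ∸ p x) (subst (_≤ m) (sym (m+[n∸m]≡n h)) (p≤m y)))

  short-walk : ∀ x y → Σ ℕ λ l → (l ≤ m) × Walk G x y l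
  short-walk x y with p x ≤? p y
  ... | yes h = p y ∸ p x , ≤-trans (m∸n≤m (p y) (p x)) (p≤m y) , walk-between x y h
  ... | no h = p x ∸ p y , ≤-trans (m∸n≤m (p x) (p y)) (p≤m x) , reverse (walk-between y x (<⇒≤ (≰⇒> h)))

  diameter : ∀ D → IsDiam G D → D ≡ m
  diameter D ((x , y , (_ , shortest)) , maximal) = ≤-antisym D≤m m≤D
    where
    D≤m : D ≤ m
    D≤m with short-walk x y
    ... | l , l≤m , w = ≤-trans (shortest l w) l≤m
    ends-distance : IsDist G (at 0) (at m) m
    ends-distance = walk-up 0 m ≤-refl , λ l w → subst₂ _≤_ (p-at m ≤-refl)
      (trans (cong (l +_) (p-at 0 z≤n)) (+-identityʳ l)) (walk-length w)
    m≤D : m ≤ D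
    m≤D = maximal (at 0) (at m) m ends-distance

  two-colours : 3 ≤ m → ∀ k → InjColorable G k → 2 ≤ k
  two-colours 3≤m k (c , injective) =
    distinct-colours k (col c (at 0) (at 1)) (col c (at 2) (at 3)) (injective (at 0) (at 1) (at 2) (at 3) first-three)
    where
    at-≢ : ∀ a b → a ≤ m → b ≤ m → ¬ a ≡ b → ¬ at a ≡ at b
    at-≢ a b ha hb a≢b e = a≢b (trans (sym (p-at a ha)) (trans (cong p e) (p-at b hb)))
    1≤m = ≤-trans (s≤s z≤n) 3≤m
    2≤m = ≤-trans (s≤s (s≤s z≤n)) 3≤m
    first-three : Consecutive G (at 0) (at 1) (at 2) (at 3)
    first-three = at-step 0 1≤m , at-step 1 2≤m , at-step 2 3≤m , at-≢ 0 2 z≤n 2≤m (λ ()) , at-≢ 1 3 1≤m 3≤m (λ ())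
    distinct-colours : ∀ k (a b : Fin k) → ¬ a ≡ b → 2 ≤ k
    distinct-colours (suc (suc k)) a b _ = s≤s (s≤s z≤n)
    distinct-colours (suc zero) zero zero a≢b = ⊥-elim (a≢b refl)

bounded-search : ∀ B (P : ℕ → Set) → (∀ a → Dec (P a)) → (∀ a → P a → a ≤ B) → Dec (∃ P)
bounded-search B P P? bounded = map′ (λ (j , pj) → toℕ j , pj)
  (λ (a , pa) → fromℕ< (s≤s (bounded a pa)) , subst P (sym (toℕ-fromℕ< (s≤s (bounded a pa)))) pa)
  (any? {n = suc B} (λ j → P? (toℕ j)))

module Extremal (G : Graph) (connected : Connected G) (D k : ℕ) {x₀ y₀ : Fin (n G)} (W : Walk G x₀ y₀ D)
                (shortest : ∀ l → Walk G x₀ y₀ l → D ≤ l) (χ : IsInjChromIndex G k) where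
  open StripedGeodesic D W shortest

  upper-bound : k ≤ size G ∸ D + 2
  upper-bound = begin
    k                  ≤⟨ m+n≤o⇒m≤o∸n k k+D≤ ⟩
    2 + size G ∸ D     ≡⟨ +-∸-assoc 2 D≤size ⟩
    2 + (size G ∸ D)   ≡⟨ +-comm 2 (size G ∸ D) ⟩
    size G ∸ D + 2     ∎
    where
    open ≤-Reasoning
    k+D≤ = proj₁ (partial-bound stripeColouring χ)
    D≤size = proj₂ (partial-bound stripeColouring χ)

  attached : ∀ {x y l} → Walk G x y l → onPath x ≡ false → onPath y ≡ true →
    Σ V λ w → (onPath w ≡ false) × Σ ℕ λ i → (i ≤ D) × Adj G (v i) w
  attached nil x-off y-on with trans (sym x-off) y-on
  ... | ()
  attached {x} (cons {y = x′} e rest) x-off y-on with onPath x′ in e′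
  ... | true = x , x-off , pos x′ , onPath-pos x′ e′ , subst (λ q → Adj G q x) (onPath-v-pos e′) (adjSym G e)
  ... | false = attached rest e′ y-on

  adj? : ∀ x y → Dec (Adj G x y)
  adj? x y = adj G x y ≟B true

  module _ (w : V) (w-off : onPath w ≡ false) where
    module Off = OffPath D W shortest w w-off

    DetourAt : ℕ → Set
    DetourAt a = (suc (suc a) ≤ D) × (Adj G (v a) w × Adj G w (v (suc (suc a))))

    TriangleAt : ℕ → Set
    TriangleAt a = (suc a ≤ D) × (Adj G (v a) w × Adj G w (v (suc a)))

    detour-≤ : ∀ a → DetourAt a → a ≤ D
    detour-≤ a d = ≤-trans (n≤1+n a) (≤-trans (n≤1+n (suc a)) (proj₁ d))

    nearby : ∀ j a → j ≤ D → a ≤ D → Adj G w (v j) → Adj G (v a) w → Near j a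
    nearby j a j≤D a≤D w~vj va~w = near j a (common-neighbour a j w a≤D j≤D va~w w~vj)
      (common-neighbour j a w j≤D a≤D (adjSym G w~vj) (adjSym G va~w))

    off-path-not-extremal : ∀ i → i ≤ D → Adj G (v i) w → ¬ k ≡ size G ∸ D + 2
    off-path-not-extremal i i≤D vi~w eq
      with bounded-search D DetourAt (λ a → suc (suc a) ≤? D ×-dec (adj? (v a) w ×-dec adj? w (v (suc (suc a))))) detour-≤
    ... | yes (a , a+2≤D , va~w , w~va+2) =
          no-equality D k (Off.Detour.certificate a a+2≤D va~w w~va+2) ≤-refl χ eq
    ... | no no-detour
      with bounded-search D TriangleAt (λ a → suc a ≤? D ×-dec (adj? (v a) w ×-dec adj? w (v (suc a)))) (λ a t → <⇒≤ (proj₁ t))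
    ...   | yes (a , a<D , va~w , w~va+1) =
            no-equality D k (Off.Triangle.certificate a a<D va~w w~va+1 only) ≤-refl χ eq
      where
      a≤D = <⇒≤ a<D
      only : ∀ j → j ≤ D → Adj G w (v j) → (j ≡ a) ⊎ (j ≡ suc a)
      only j j≤D w~vj with nearby j a j≤D a≤D w~vj va~w
      ... | same = inj₁ refl
      ... | p1 = inj₂ refl
      ... | m1 = ⊥-elim (no-detour (j , a<D , adjSym G w~vj , w~va+1))
      ... | p2 = ⊥-elim (no-detour (a , j≤D , va~w , w~vj))
      ... | m2 = ⊥-elim (1+n≰n (common-neighbour j (suc a) w j≤D a<D (adjSym G w~vj) w~va+1))
    ...   | no no-triangle = no-equality D k (Off.Pendant.certificate i i≤D vi~w unique) ≤-refl χ eq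
      where
      unique : ∀ j → j ≤ D → Adj G w (v j) → j ≡ i
      unique j j≤D w~vj with nearby j i j≤D i≤D w~vj vi~w
      ... | same = refl
      ... | p1 = ⊥-elim (no-triangle (i , j≤D , vi~w , w~vj))
      ... | m1 = ⊥-elim (no-triangle (j , i≤D , adjSym G w~vj , adjSym G vi~w))
      ... | p2 = ⊥-elim (no-detour (i , j≤D , vi~w , w~vj))
      ... | m2 = ⊥-elim (no-detour (j , i≤D , adjSym G w~vj , adjSym G vi~w))

  module Spanning (on : ∀ x → onPath x ≡ true) where
    open Extend stripeColouring using (uncoveredCount; colour-bound; covered-bound; all-covered)

    size≡D : k ≡ size G ∸ D + 2 → size G ≡ D
    size≡D eq = ≤-antisym (m∸n≡0⇒m≤n (n≤0⇒n≡0 (+-cancelʳ-≤ 2 (size G ∸ D) 0 (begin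
        size G ∸ D + 2   ≡⟨ eq ⟨
        k                ≤⟨ colour-bound k χ ⟩
        2 + uncoveredCount ≡⟨ cong (2 +_) (all-covered (λ x y _ → ∧-true (on x) (on y))) ⟩
        2                ∎))))
      (≤-trans (m≤n+m D uncoveredCount) covered-bound)
      where open ≤-Reasoning

    to : V → Fin (suc D)
    to x = fromℕ< (s≤s (onPath-pos x (on x)))

    toℕ-to : ∀ x → toℕ (to x) ≡ pos x
    toℕ-to x = toℕ-fromℕ< (s≤s (onPath-pos x (on x)))

    from : Fin (suc D) → V
    from j = v (toℕ j)

    adj-pos-nbrᵇ : ∀ x y → adj G x y ≡ nbrᵇ (pos x) (pos y)
    adj-pos-nbrᵇ x y with adj G x y in e
    ... | true = sym (nbrᵇ-complete (adj-pos (on x) (on y) e))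
    ... | false with nbrᵇ (pos x) (pos y) in e′
    ...   | false = refl
    ...   | true = ⊥-elim (true≢false (sym (trans (sym e)
                     (subst₂ (Adj G) (sym (onPath-v-pos (on x))) (sym (onPath-v-pos (on y)))
                       (nbr-adj (onPath-pos x (on x)) (onPath-pos y (on y)) (nbrᵇ-sound _ _ e′))))))
      where
      nbr-adj : ∀ {p q} → p ≤ D → q ≤ D → Nbr p q → Adj G (v p) (v q)
      nbr-adj p≤D q≤D up = step _ q≤D
      nbr-adj p≤D q≤D dn = adjSym G (step _ p≤D)

    isoToPath : IsoToPath G D
    isoToPath = mk↔ₛ′ to from to-from from-to ,
      λ x y → trans (adj-pos-nbrᵇ x y) (sym (cong₂ nbrᵇ (toℕ-to x) (toℕ-to y)))
      where
      to-from : ∀ j → to (from j) ≡ j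
      to-from j = toℕ-injective (trans (toℕ-to (v (toℕ j))) (pos-v (toℕ j) (≤-pred (toℕ<n j))))
      from-to : ∀ x → from (to x) ≡ x
      from-to x = trans (cong v (toℕ-to x)) (sym (onPath-v-pos (on x)))

  extremal⇒path : k ≡ size G ∸ D + 2 → IsoToPath G (size G)
  extremal⇒path eq with any? (λ x → onPath x ≟B false)
  ... | yes (u , u-off) with attached (proj₂ (connected u (v 0))) u-off (onPath-v 0 z≤n)
  ...   | w , w-off , i , i≤D , vi~w = ⊥-elim (off-path-not-extremal w w-off i i≤D vi~w eq)
  extremal⇒path eq | no none = subst (IsoToPath G) (sym (Spanning.size≡D on eq)) (Spanning.isoToPath on)
    where
    on : ∀ x → onPath x ≡ true
    on x with onPath x in e
    ... | true = refl
    ... | false = ⊥-elim (none (x , e))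

path⇒extremal : ∀ G D k → 3 ≤ size G → IsDiam G D → IsInjChromIndex G k → k ≤ size G ∸ D + 2 →
  IsoToPath G (size G) → k ≡ size G ∸ D + 2
path⇒extremal G D k 3≤size diam (colourable , _) k≤ (f , f-adj) = ≤-antisym k≤ (begin
  size G ∸ D + 2       ≡⟨ cong (λ d → size G ∸ d + 2) (diameter D diam) ⟩
  size G ∸ size G + 2  ≡⟨ cong (_+ 2) (n∸n≡0 (size G)) ⟩
  2                    ≤⟨ two-colours 3≤size k colourable ⟩
  k                    ∎)
  where open PathGraph G (size G) f f-adj
        open ≤-Reasoning

proposition11 : (G : Graph) → Connected G → 3 ≤ size G →
    ∀ (D k : ℕ) → IsDiam G D → IsInjChromIndex G k →
      (k ≤ size G ∸ D + 2) × ((k ≡ size G ∸ D + 2) ⇔ IsoToPath G (size G))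
proposition11 G connected 3≤size D k diam@((x₀ , y₀ , W , shortest) , _) χ =
  upper-bound , mk⇔ extremal⇒path (path⇒extremal G D k 3≤size diam χ upper-bound)
  where open Extremal G connected D k W shortest χ
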